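{- Let $n$ be a positive integer. Then for any polynomial $f(x)$ (with complex coefficients) we have the polynomial identity in $x$ $$ \sum_{k}\left\langle {n \atop k}\right\rangle f(k)x^k=\sum_{m=0}^{n}m!S(n,m)\sum_{i=0}^{n-m}\binom{n-m}{i}(-1)^{n-m-i}f(i)x^i . $$
   Context: For $n\ge1$, the Eulerian number $\left\langle {n \atop k}\right\rangle$ is the number of permutations $a_1\cdots a_n$ of $\{1,\dots,n\}$ with exactly $k$ ascents (indices $i\le n-1$ with $a_i<a_{i+1}$); it is $0$ for $k<0$ or $k>n-1$, and the left sum runs over all integers $k$. The Stirling numbers of the second kind $S(n,m)$ are defined by $x^n=\sum_{m=0}^n S(n,m)m!\binom{x}{m}$. -}

module Defs where

open import Level using (Level)
open import Data.Nat as ℕ using (ℕ; zero; suc; _∸_; _≤?_; _<ᵇ_)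
open import Data.Nat.Combinatorics using (_C_)
open import Data.Nat using (_!)
open import Data.Bool using (Bool; true; false; if_then_else_)
open import Data.List using (List; []; _∷_; concatMap; map; applyUpTo; filter; length; replicate; _++_)
open import Data.List.Relation.Unary.Unique.DecPropositional ℕ._≟_ using (unique?)
open import Relation.Binary.PropositionalEquality using (_≡_)
open import Relation.Nullary using (Dec)
open import Algebra.Bundles using (CommutativeRing)

words : ℕ → ℕ → List (List ℕ)
words zero    n = [] ∷ []
words (suc l) n = concatMap (λ w → map (_∷ w) (applyUpTo suc n)) (words l n)

ascents : List ℕ → ℕ
ascents []             = 0
ascents (a ∷ [])       = 0
ascents (a ∷ b ∷ rest) = (if a <ᵇ b then 1 else 0) ℕ.+ ascents (b ∷ rest)

permutations : ℕ → List (List ℕ)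
permutations n = filter unique? (words n n)

eulerian : ℕ → ℕ → ℕ
eulerian n k = length (filter (λ w → ascents w ℕ.≟ k) (permutations n))

sumℕ : ℕ → (ℕ → ℕ) → ℕ
sumℕ zero    g = g 0
sumℕ (suc n) g = sumℕ n g ℕ.+ g (suc n)

-- Stirling numbers of the second kind are characterised by their defining identity
--   x^n = Σ_{m=0}^{n} S(n,m) m! (x choose m)   for all natural x.
IsStirling2 : (ℕ → ℕ → ℕ) → Set
IsStirling2 S = ∀ n x → x ℕ.^ n ≡ sumℕ n (λ m → S n m ℕ.* (m !) ℕ.* (x C m))

-- Polynomials over a commutative ring, as coefficient lists
-- (constant coefficient first).

module PolyDefs {c ℓ : Level} (R : CommutativeRing c ℓ) where
  open CommutativeRing R

  Poly : Set c
  Poly = List Carrier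

  coeff : Poly → ℕ → Carrier
  coeff []       _       = 0#
  coeff (a ∷ p)  zero    = a
  coeff (a ∷ p)  (suc j) = coeff p j

  _≋_ : Poly → Poly → Set ℓ
  p ≋ q = ∀ j → coeff p j ≈ coeff q j

  _⊕_ : Poly → Poly → Poly
  []      ⊕ q       = q
  (a ∷ p) ⊕ []      = a ∷ p
  (a ∷ p) ⊕ (b ∷ q) = (a + b) ∷ (p ⊕ q)

  mono : Carrier → ℕ → Poly
  mono a i = replicate i 0# ++ (a ∷ [])

  sumP : ℕ → (ℕ → Poly) → Poly
  sumP zero    g = g 0
  sumP (suc n) g = sumP n g ⊕ g (suc n)

  fromℕ : ℕ → Carrier
  fromℕ zero    = 0#
  fromℕ (suc n) = 1# + fromℕ n

  negOnePow : ℕ → Carrier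
  negOnePow zero    = 1#
  negOnePow (suc e) = - negOnePow e

  eval : Poly → Carrier → Carrier
  eval []      _ = 0#
  eval (a ∷ p) t = a + t * eval p t

  -- LHS: Σ_k ⟨n k⟩ f(k) x^k   (⟨n k⟩ = 0 outside 0 ≤ k ≤ n-1, so k ranges over 0..n)
  lhs : ℕ → Poly → Poly
  lhs n f = sumP n (λ k → mono (fromℕ (eulerian n k) * eval f (fromℕ k)) k)

  rhs : (ℕ → ℕ → ℕ) → ℕ → Poly → Poly
  rhs S n f = sumP n (λ m →
    sumP (n ∸ m) (λ i →
      mono (fromℕ ((m !) ℕ.* S n m) *
            (fromℕ ((n ∸ m) C i) * (negOnePow ((n ∸ m) ∸ i) * eval f (fromℕ i)))) i))

{-# OPTIONS --safe #-}
module Submission where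

-- Inserting the letter n+1 into the permutations of {1,…,n} produces every permutation of
-- {1,…,n+1} exactly once; an insertion into a word with a ascents yields a ascents in a+1
-- positions and a+1 ascents in the remaining n−a.  This gives the recurrence
-- ⟨n+1, k+1⟩ = (k+2)⟨n, k+1⟩ + (n−k)⟨n, k⟩ and from it Worpitzky's identity
-- x^n = Σ_k ⟨n k⟩ C(x+k, n).  Expanding C(x+k, n) by Vandermonde and comparing coefficients
-- in the basis C(x, m) gives m! S(n,m) = Σ_k ⟨n k⟩ C(k, n−m).  Substituting this into the
-- right-hand side and exchanging sums, the coefficient of x^j becomes
-- Σ_k ⟨n k⟩ f(j) Σ_p C(k,p) C(p,j) (−1)^(p−j), and the inner sum is δ_kj by binomial inversion.

open import Defs
open import Data.Nat using (ℕ; suc; _≤_)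
open import Algebra.Bundles using (CommutativeRing)

open import Algebra.Bundles using (CommutativeSemiring)
open import Data.Nat using (zero; _<_; _∸_; z≤n; s≤s)
open import Data.Nat.Properties using (≤-refl; m≤n⇒m≤1+n; m≤n⇒m<n∨m≡n; +-*-commutativeSemiring)
open import Data.Sum using (inj₁; inj₂)
open import Function using (_∘_)
open import Relation.Binary.PropositionalEquality using (_≡_; _≢_; refl)
open import Data.Empty using (⊥-elim)

module RangeSum {c ℓ} (R : CommutativeSemiring c ℓ) where

  open CommutativeSemiring R renaming (refl to ≈-refl)
  open import Relation.Binary.Reasoning.Setoid setoid
  open import Algebra.Properties.CommutativeSemigroup +-commutativeSemigroup using (interchange)

  sumTo : ℕ → (ℕ → Carrier) → Carrier
  sumTo zero    g = g 0
  sumTo (suc n) g = sumTo n g + g (suc n)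

  sumTo-cong : ∀ n {f g : ℕ → Carrier} → (∀ k → k ≤ n → f k ≈ g k) → sumTo n f ≈ sumTo n g
  sumTo-cong zero    f≈g = f≈g 0 z≤n
  sumTo-cong (suc n) f≈g = +-cong (sumTo-cong n (λ k k≤n → f≈g k (m≤n⇒m≤1+n k≤n))) (f≈g (suc n) ≤-refl)

  sumTo-zero : ∀ n {f : ℕ → Carrier} → (∀ k → k ≤ n → f k ≈ 0#) → sumTo n f ≈ 0#
  sumTo-zero zero    f≈0 = f≈0 0 z≤n
  sumTo-zero (suc n) f≈0 =
    trans (+-cong (sumTo-zero n (λ k k≤n → f≈0 k (m≤n⇒m≤1+n k≤n))) (f≈0 (suc n) ≤-refl)) (+-identityʳ 0#)

  sumTo-distrib-+ : ∀ n (f g : ℕ → Carrier) → sumTo n (λ k → f k + g k) ≈ sumTo n f + sumTo n g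
  sumTo-distrib-+ zero    f g = ≈-refl
  sumTo-distrib-+ (suc n) f g = trans (+-congʳ (sumTo-distrib-+ n f g)) (interchange _ _ _ _)

  *-distribˡ-sumTo : ∀ n x (f : ℕ → Carrier) → x * sumTo n f ≈ sumTo n (λ k → x * f k)
  *-distribˡ-sumTo zero    x f = ≈-refl
  *-distribˡ-sumTo (suc n) x f = trans (distribˡ x _ _) (+-congʳ (*-distribˡ-sumTo n x f))

  *-distribʳ-sumTo : ∀ n x (f : ℕ → Carrier) → sumTo n f * x ≈ sumTo n (λ k → f k * x)
  *-distribʳ-sumTo zero    x f = ≈-refl
  *-distribʳ-sumTo (suc n) x f = trans (distribʳ x _ _) (+-congʳ (*-distribʳ-sumTo n x f))

  sumTo-suc : ∀ n (g : ℕ → Carrier) → sumTo (suc n) g ≈ g 0 + sumTo n (g ∘ suc)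
  sumTo-suc zero    g = ≈-refl
  sumTo-suc (suc n) g = trans (+-congʳ (sumTo-suc n g)) (+-assoc _ _ _)

  sumTo-comm : ∀ n p (f : ℕ → ℕ → Carrier) →
    sumTo n (λ k → sumTo p (f k)) ≈ sumTo p (λ m → sumTo n (λ k → f k m))
  sumTo-comm zero    p f = ≈-refl
  sumTo-comm (suc n) p f = trans (+-congʳ (sumTo-comm n p f)) (sym (sumTo-distrib-+ p _ (f (suc n))))

  sumTo-reverse : ∀ n (g : ℕ → Carrier) → sumTo n (λ m → g (n ∸ m)) ≈ sumTo n g
  sumTo-reverse zero    g = ≈-refl
  sumTo-reverse (suc n) g =
    trans (sumTo-suc n (λ m → g (suc n ∸ m))) (trans (+-congˡ (sumTo-reverse n g)) (+-comm _ _))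

  sumTo-truncate : ∀ {j n} (f : ℕ → Carrier) → j ≤ n → (∀ m → j < m → f m ≈ 0#) → sumTo n f ≈ sumTo j f
  sumTo-truncate {n = zero}  f z≤n   _   = ≈-refl
  sumTo-truncate {n = suc n} f j≤1+n f≈0 with m≤n⇒m<n∨m≡n j≤1+n
  ... | inj₂ refl        = ≈-refl
  ... | inj₁ (s≤s j≤n) =
    trans (+-cong (sumTo-truncate f j≤n f≈0) (f≈0 (suc n) (s≤s j≤n))) (+-identityʳ _)

module ℕΣ = RangeSum +-*-commutativeSemiring

module Eulerian where

  open import Data.Nat as ℕ using (_+_; _*_; _<ᵇ_)
  open import Data.Nat.Properties
    using (<-irrefl; 1+n≰n; ≤∧≢⇒<; <⇒≢; <⇒≤; <⇒≱; m<n⇒m<1+n; suc-injective; <ᵇ⇒<; <⇒<ᵇ;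
           +-∸-assoc; m≤n⇒m∸n≡0; *-zeroʳ; +-identityʳ; *-identityˡ; module ≤-Reasoning)
  open import Data.Nat.Tactic.RingSolver using (solve-∀)
  open import Data.Bool using (Bool; true; false; if_then_else_)
  open import Data.Bool.Properties using (T-≡; ¬-not)
  open import Data.List using (List; []; _∷_; [_]; _++_; map; concatMap; applyUpTo; filter; length; replicate; cartesianProductWith)
  open import Data.List.Properties
    using (length-applyUpTo; length-++; filter-++; filter-all; filter-reject; ∷-injective; ∷-injectiveˡ; ∷-injectiveʳ;
           map-id; map-++; map-replicate; map-concatMap; concatMap-map)
  open import Data.List.Relation.Unary.All as All using (All; []; _∷_)
  open import Data.List.Relation.Unary.All.Properties as Allₚ using (¬Any⇒All¬)
  open import Data.List.Relation.Unary.Any as Any using (Any; here; there)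
  open import Data.List.Relation.Unary.AllPairs using ([]; _∷_)
  open import Data.List.Relation.Unary.Unique.Propositional using (Unique)
  import Data.List.Relation.Unary.Unique.Propositional.Properties as Unique
  open import Data.List.Relation.Unary.Unique.DecPropositional ℕ._≟_ using (unique?)
  open import Data.List.Membership.Propositional using (_∈_; _∉_; find)
  open import Data.List.Membership.Propositional.Properties
  open import Data.List.Membership.DecPropositional ℕ._≟_ using (_∈?_)
  open import Data.List.Membership.Propositional.Properties.WithK using (unique∧set⇒bag)
  open import Data.List.Relation.Binary.BagAndSetEquality using (∼bag⇒↭)
  open import Data.List.Relation.Binary.Permutation.Propositional
    using (_↭_; ↭-sym; ↭-refl; ↭-trans; ↭-reflexive; ↭-prep; ↭⇒↭ₛ; module PermutationReasoning)
  open import Data.List.Relation.Binary.Permutation.Propositional.Properties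
    using (shift; drop-∷; ↭-length; All-resp-↭; Any-resp-↭; filter-↭; ++⁺)
  import Data.List.Relation.Binary.Permutation.Propositional.Properties as Perm
  import Data.List.Relation.Binary.Permutation.Setoid.Properties as Permₛ
  open import Data.Product using (∃₂; _×_; _,_; swap)
  open import Function.Bundles using (Equivalence; mk⇔)
  open import Relation.Nullary using (¬_; Dec; yes; no; ¬?)
  open import Relation.Binary.PropositionalEquality hiding ([_])

  -- Permutations as duplicate-free words

  module _ {A : Set} where

    ∈-++-∷⁻ : ∀ {x y : A} u₁ u₂ → y ∈ u₁ ++ x ∷ u₂ → x ≢ y → y ∈ u₁ ++ u₂
    ∈-++-∷⁻ {x} u₁ u₂ y∈ x≢y with Any-resp-↭ (shift x u₁ u₂) y∈
    ... | here refl = ⊥-elim (x≢y refl)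
    ... | there y∈u = y∈u

    unique-⊆⇒length≤ : ∀ {xs ys : List A} → Unique xs → All (_∈ ys) xs → length xs ≤ length ys
    unique-⊆⇒length≤ {[]} _ _ = z≤n
    unique-⊆⇒length≤ {x ∷ xs} (x∉xs ∷ xs!) (x∈ys ∷ xs⊆ys) with ∈-∃++ x∈ys
    ... | u₁ , u₂ , refl = begin
      suc (length xs)                ≤⟨ s≤s (unique-⊆⇒length≤ xs! (All.zipWith remove (x∉xs , xs⊆ys))) ⟩
      suc (length (u₁ ++ u₂))        ≡⟨ ↭-length (shift x u₁ u₂) ⟨
      length (u₁ ++ x ∷ u₂)          ∎
      where
      open ≤-Reasoning
      remove : ∀ {y} → x ≢ y × y ∈ u₁ ++ x ∷ u₂ → y ∈ u₁ ++ u₂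
      remove (x≢y , y∈) = ∈-++-∷⁻ u₁ u₂ y∈ x≢y

  letters : ℕ → List ℕ
  letters n = applyUpTo suc n

  ∈-letters⇒≤ : ∀ {a n} → a ∈ letters n → a ≤ n
  ∈-letters⇒≤ a∈ with ∈-applyUpTo⁻ suc a∈
  ... | _ , i<n , refl = i<n

  suc∈letters : ∀ n → suc n ∈ letters (suc n)
  suc∈letters n = ∈-applyUpTo⁺ suc ≤-refl

  ∈-letters-suc⁺ : ∀ {a n} → a ∈ letters n → a ∈ letters (suc n)
  ∈-letters-suc⁺ a∈ with ∈-applyUpTo⁻ suc a∈
  ... | _ , i<n , refl = ∈-applyUpTo⁺ suc (m≤n⇒m≤1+n i<n)

  ∈-letters-suc⁻ : ∀ {a n} → a ∈ letters (suc n) × suc n ≢ a → a ∈ letters n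
  ∈-letters-suc⁻ (a∈ , n≢a) with ∈-applyUpTo⁻ suc a∈
  ... | i , s≤s i≤n , refl = ∈-applyUpTo⁺ suc (≤∧≢⇒< i≤n (n≢a ∘ cong suc ∘ sym))

  ∉-letters : ∀ {n w} → All (_∈ letters n) w → suc n ∉ w
  ∉-letters w⊆ n∈w = <-irrefl refl (All.lookup (All.map ∈-letters⇒≤ w⊆) n∈w)

  ∈-words⁺ : ∀ {n} v → All (_∈ letters n) v → v ∈ words (length v) n
  ∈-words⁺ [] [] = here refl
  ∈-words⁺ {n} (a ∷ v) (a∈ ∷ v⊆) =
    ∈-concatMap⁺ (λ w → map (_∷ w) (letters n)) (Any.map (λ { refl → ∈-map⁺ (_∷ v) a∈ }) (∈-words⁺ v v⊆))

  ∈-words⁻ : ∀ l {n v} → v ∈ words l n → length v ≡ l × All (_∈ letters n) v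
  ∈-words⁻ zero (here refl) = refl , []
  ∈-words⁻ (suc l) {n} v∈ with find (∈-concatMap⁻ (λ w → map (_∷ w) (letters n)) {xs = words l n} v∈)
  ... | w , w∈ , v∈w with ∈-map⁻ (_∷ w) v∈w
  ... | a , a∈ , refl with ∈-words⁻ l w∈
  ... | refl , w⊆ = refl , a∈ ∷ w⊆

  words-suc≡cartesianProductWith : ∀ l n →
    words (suc l) n ≡ cartesianProductWith (λ w a → a ∷ w) (words l n) (letters n)
  words-suc≡cartesianProductWith l n = go (words l n)
    where
    go : ∀ W → concatMap (λ w → map (_∷ w) (letters n)) W ≡ cartesianProductWith (λ w a → a ∷ w) W (letters n)
    go []      = refl
    go (w ∷ W) = cong (map (_∷ w) (letters n) ++_) (go W)

  words-unique : ∀ l n → Unique (words l n)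
  words-unique zero n = [] ∷ []
  words-unique (suc l) n rewrite words-suc≡cartesianProductWith l n =
    Unique.cartesianProductWith⁺ (λ w a → a ∷ w) (swap ∘ ∷-injective) (words-unique l n)
      (Unique.applyUpTo⁺₁ suc n (λ i<j _ → <⇒≢ i<j ∘ suc-injective))

  IsPermutation : ℕ → List ℕ → Set
  IsPermutation n v = length v ≡ n × All (_∈ letters n) v × Unique v

  IsPermutation-resp-↭ : ∀ {n v w} → v ↭ w → IsPermutation n v → IsPermutation n w
  IsPermutation-resp-↭ v↭w (len , v⊆ , v!) =
    trans (sym (↭-length v↭w)) len , All-resp-↭ v↭w v⊆ , Permₛ.Unique-resp-↭ (setoid ℕ) (↭⇒↭ₛ v↭w) v!

  ∈-permutations⁺ : ∀ {n v} → IsPermutation n v → v ∈ permutations n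
  ∈-permutations⁺ {v = v} (refl , v⊆ , v!) = ∈-filter⁺ unique? (∈-words⁺ v v⊆) v!

  ∈-permutations⁻ : ∀ {n v} → v ∈ permutations n → IsPermutation n v
  ∈-permutations⁻ {n} v∈ with ∈-filter⁻ unique? {xs = words n n} v∈
  ... | v∈words , v! with ∈-words⁻ n v∈words
  ... | len , v⊆ = len , v⊆ , v!

  permutations-unique : ∀ n → Unique (permutations n)
  permutations-unique n = Unique.filter⁺ unique? (words-unique n n)

  max∈permutation : ∀ {n v} → IsPermutation (suc n) v → suc n ∈ v
  max∈permutation {n} {v} (len , v⊆ , v!) with suc n ∈? v
  ... | yes n∈v = n∈v
  ... | no  n∉v = ⊥-elim (1+n≰n (begin
    suc n               ≡⟨ len ⟨
    length v            ≤⟨ unique-⊆⇒length≤ v! (All.zipWith ∈-letters-suc⁻ (v⊆ , ¬Any⇒All¬ v n∉v)) ⟩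
    length (letters n)  ≡⟨ length-applyUpTo suc n ⟩
    n                   ∎))
    where open ≤-Reasoning

  IsPermutation-cons : ∀ {n w} → IsPermutation n w → IsPermutation (suc n) (suc n ∷ w)
  IsPermutation-cons {n} (len , w⊆ , w!) =
    cong suc len , suc∈letters n ∷ All.map ∈-letters-suc⁺ w⊆ , ¬Any⇒All¬ _ (∉-letters w⊆) ∷ w!

  IsPermutation-uncons : ∀ {n w} → IsPermutation (suc n) (suc n ∷ w) → IsPermutation n w
  IsPermutation-uncons (len , _ ∷ w⊆ , n∉w ∷ w!) =
    suc-injective len , All.zipWith ∈-letters-suc⁻ (w⊆ , n∉w) , w!

  -- Inserting the largest letter

  insertions : ℕ → List ℕ → List (List ℕ)
  insertions N []      = [ N ] ∷ []
  insertions N (b ∷ w) = (N ∷ b ∷ w) ∷ map (b ∷_) (insertions N w)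

  ∈-insertions⁺ : ∀ N u₁ u₂ → u₁ ++ N ∷ u₂ ∈ insertions N (u₁ ++ u₂)
  ∈-insertions⁺ N []       []       = here refl
  ∈-insertions⁺ N []       (b ∷ u₂) = here refl
  ∈-insertions⁺ N (b ∷ u₁) u₂       = there (∈-map⁺ (b ∷_) (∈-insertions⁺ N u₁ u₂))

  ∈-insertions⁻ : ∀ {N} w {v} → v ∈ insertions N w → ∃₂ λ u₁ u₂ → w ≡ u₁ ++ u₂ × v ≡ u₁ ++ N ∷ u₂
  ∈-insertions⁻ []      (here refl) = [] , [] , refl , refl
  ∈-insertions⁻ (b ∷ w) (here refl) = [] , b ∷ w , refl , refl
  ∈-insertions⁻ (b ∷ w) (there v∈) with ∈-map⁻ (b ∷_) v∈
  ... | _ , v′∈ , refl with ∈-insertions⁻ w v′∈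
  ... | u₁ , u₂ , refl , refl = b ∷ u₁ , u₂ , refl , refl

  delete : ℕ → List ℕ → List ℕ
  delete N = filter (¬? ∘ (N ℕ.≟_))

  delete-insertion : ∀ {N} w {v} → N ∉ w → v ∈ insertions N w → delete N v ≡ w
  delete-insertion {N} w N∉w v∈ with ∈-insertions⁻ w v∈
  ... | u₁ , u₂ , refl , refl with Allₚ.++⁻ u₁ (¬Any⇒All¬ (u₁ ++ u₂) N∉w)
  ... | N∉u₁ , N∉u₂ = begin
    delete N (u₁ ++ N ∷ u₂)           ≡⟨ filter-++ N≢? u₁ (N ∷ u₂) ⟩
    delete N u₁ ++ delete N (N ∷ u₂)  ≡⟨ cong (delete N u₁ ++_) (filter-reject N≢? (λ N≢N → N≢N refl)) ⟩
    delete N u₁ ++ delete N u₂        ≡⟨ cong₂ _++_ (filter-all N≢? N∉u₁) (filter-all N≢? N∉u₂) ⟩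
    u₁ ++ u₂                          ∎
    where
    open ≡-Reasoning
    N≢? : ∀ a → Dec (N ≢ a)
    N≢? = ¬? ∘ (N ℕ.≟_)

  insertions-unique : ∀ {N} w → N ∉ w → Unique (insertions N w)
  insertions-unique []      _   = [] ∷ []
  insertions-unique (b ∷ w) N∉w =
    Allₚ.map⁺ (All.universal (λ _ eq → N∉w (here (∷-injectiveˡ eq))) _)
    ∷ Unique.map⁺ ∷-injectiveʳ (insertions-unique w (N∉w ∘ there))

  concatMap-unique : ∀ {A B : Set} (g : A → List B) {xs} → Unique xs →
    (∀ {x} → x ∈ xs → Unique (g x)) →
    (∀ {x y z} → x ∈ xs → y ∈ xs → z ∈ g x → z ∈ g y → x ≡ y) →
    Unique (concatMap g xs)
  concatMap-unique g {[]}     _            _  _     = []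
  concatMap-unique g {x ∷ xs} (x∉xs ∷ xs!) g! g-inj =
    Unique.++⁺ (g! (here refl)) (concatMap-unique g xs! (g! ∘ there) (λ p q → g-inj (there p) (there q))) disjoint
    where
    disjoint : ∀ {z} → ¬ (z ∈ g x × z ∈ concatMap g xs)
    disjoint (z∈gx , z∈) with find (∈-concatMap⁻ g {xs = xs} z∈)
    ... | y , y∈xs , z∈gy = All.lookup x∉xs y∈xs (g-inj (here refl) (there y∈xs) z∈gx z∈gy)

  permutations-suc↭ : ∀ n → permutations (suc n) ↭ concatMap (insertions (suc n)) (permutations n)
  permutations-suc↭ n = ∼bag⇒↭ (unique∧set⇒bag (permutations-unique (suc n)) unique (mk⇔ to from))
    where
    N : ℕ
    N = suc n
    N∉ : ∀ {w} → w ∈ permutations n → N ∉ w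
    N∉ w∈ with ∈-permutations⁻ w∈
    ... | _ , w⊆ , _ = ∉-letters w⊆
    unique : Unique (concatMap (insertions N) (permutations n))
    unique = concatMap-unique (insertions N) (permutations-unique n) (λ w∈ → insertions-unique _ (N∉ w∈))
      (λ w∈ w′∈ v∈ v∈′ → trans (sym (delete-insertion _ (N∉ w∈) v∈)) (delete-insertion _ (N∉ w′∈) v∈′))
    to : ∀ {v} → v ∈ permutations N → v ∈ concatMap (insertions N) (permutations n)
    to v∈ with ∈-permutations⁻ v∈
    ... | perm with ∈-∃++ (max∈permutation {n} perm)
    ... | u₁ , u₂ , refl =
      ∈-concatMap⁺ (insertions N) (Any.map (λ { refl → ∈-insertions⁺ N u₁ u₂ })
        (∈-permutations⁺ (IsPermutation-uncons (IsPermutation-resp-↭ (shift N u₁ u₂) perm))))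
    from : ∀ {v} → v ∈ concatMap (insertions N) (permutations n) → v ∈ permutations N
    from v∈ with find (∈-concatMap⁻ (insertions N) {xs = permutations n} v∈)
    ... | w , w∈ , v∈w with ∈-insertions⁻ w v∈w
    ... | u₁ , u₂ , refl , refl =
      ∈-permutations⁺ (IsPermutation-resp-↭ (↭-sym (shift N u₁ u₂)) (IsPermutation-cons (∈-permutations⁻ w∈)))

  bit : Bool → ℕ
  bit b = if b then 1 else 0

  <⇒<ᵇ≡true : ∀ {m n} → m < n → (m <ᵇ n) ≡ true
  <⇒<ᵇ≡true m<n = Equivalence.to T-≡ (<⇒<ᵇ m<n)

  ≤⇒≮ᵇ : ∀ {m n} → m ≤ n → (n <ᵇ m) ≡ false
  ≤⇒≮ᵇ {m} {n} m≤n = ¬-not (λ n<ᵇm → <⇒≱ (<ᵇ⇒< n m (Equivalence.from T-≡ n<ᵇm)) m≤n)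

  ascents≤length : ∀ c w → ascents (c ∷ w) ≤ length w
  ascents≤length c []      = z≤n
  ascents≤length c (d ∷ w) with c <ᵇ d
  ... | true  = s≤s (ascents≤length d w)
  ... | false = m≤n⇒m≤1+n (ascents≤length d w)

  ascents-max-∷ : ∀ {N c} w → c < N → ascents (N ∷ c ∷ w) ≡ ascents (c ∷ w)
  ascents-max-∷ w c<N rewrite ≤⇒≮ᵇ (<⇒≤ c<N) = refl

  ascents-∷-max-∷ : ∀ {N b c} w → b < N → c < N → ascents (b ∷ N ∷ c ∷ w) ≡ suc (ascents (c ∷ w))
  ascents-∷-max-∷ w b<N c<N rewrite <⇒<ᵇ≡true b<N = cong suc (ascents-max-∷ w c<N)

  map-ascents-∷-∷ : ∀ b c X →
    map ascents (map (b ∷_) (map (c ∷_) X)) ≡ map (bit (b <ᵇ c) +_) (map ascents (map (c ∷_) X))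
  map-ascents-∷-∷ b c []      = refl
  map-ascents-∷-∷ b c (x ∷ X) = cong (_ ∷_) (map-ascents-∷-∷ b c X)

  -- Inserting a new maximum into a word of length l with a ascents: at the front or into
  -- one of the a ascents keeps a ascents; at the end or into one of the descents adds one.
  insertionAscents : ℕ → ℕ → List ℕ
  insertionAscents l a = replicate (suc a) a ++ replicate (l ∸ a) (suc a)

  insertionAscents-step : ∀ β l a T → a ≤ suc l →
    a ∷ T ↭ insertionAscents (suc l) a →
    bit β + a ∷ suc a ∷ map (bit β +_) T ↭ insertionAscents (suc (suc l)) (bit β + a)
  insertionAscents-step true l a T _ a∷T↭ =
    ↭-prep (suc a) (↭-prep (suc a) (↭-trans (Perm.map⁺ suc (drop-∷ a∷T↭)) (↭-reflexive (begin
      map suc (replicate a a ++ R)               ≡⟨ map-++ suc (replicate a a) R ⟩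
      map suc (replicate a a) ++ map suc R       ≡⟨ cong₂ _++_ (map-replicate suc a a) (map-replicate suc (suc l ∸ a) (suc a)) ⟩
      replicate a (suc a) ++ replicate (suc l ∸ a) (suc (suc a)) ∎))))
    where
    open ≡-Reasoning
    R : List ℕ
    R = replicate (suc l ∸ a) (suc a)
  insertionAscents-step false l a T a≤1+l a∷T↭ rewrite +-∸-assoc 1 a≤1+l =
    ↭-prep a (↭-trans (↭-prep (suc a) (↭-trans (↭-reflexive (map-id T)) (drop-∷ a∷T↭)))
                      (↭-sym (shift (suc a) (replicate a a) _)))

  ascents-insertions : ∀ {N} w → All (_< N) w →
    map ascents (insertions N w) ↭ insertionAscents (length w) (ascents w)
  ascents-insertions [] [] = ↭-refl
  ascents-insertions (b ∷ []) (b<N ∷ []) rewrite ≤⇒≮ᵇ (<⇒≤ b<N) | <⇒<ᵇ≡true b<N = ↭-refl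
  ascents-insertions {N} (b ∷ cw@(c ∷ w)) (b<N ∷ cw<N@(c<N ∷ _)) = begin
    map ascents (insertions N (b ∷ c ∷ w))
      ≡⟨ cong₂ _∷_ (ascents-max-∷ (c ∷ w) b<N)
           (cong₂ _∷_ (ascents-∷-max-∷ w b<N c<N) (map-ascents-∷-∷ b c (insertions N w))) ⟩
    bit β + a ∷ suc a ∷ map (bit β +_) T
      ↭⟨ insertionAscents-step β (length w) a T (m≤n⇒m≤1+n (ascents≤length c w))
           (subst (λ h → h ∷ T ↭ insertionAscents (length cw) a) (ascents-max-∷ w c<N)
             (ascents-insertions cw cw<N)) ⟩
    insertionAscents (length (b ∷ c ∷ w)) (ascents (b ∷ c ∷ w)) ∎
    where
    open PermutationReasoning
    β : Bool
    β = b <ᵇ c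
    a : ℕ
    a = ascents (c ∷ w)
    T : List ℕ
    T = map ascents (map (c ∷_) (insertions N w))

  concatMap-↭ : ∀ {A B : Set} {f g : A → List B} xs → (∀ {x} → x ∈ xs → f x ↭ g x) →
    concatMap f xs ↭ concatMap g xs
  concatMap-↭ []       _     = ↭-refl
  concatMap-↭ (x ∷ xs) f↭g = ++⁺ (f↭g (here refl)) (concatMap-↭ xs (f↭g ∘ there))

  ascentNumbers : ℕ → List ℕ
  ascentNumbers n = map ascents (permutations n)

  ascentNumbers-suc : ∀ n → ascentNumbers (suc n) ↭ concatMap (insertionAscents n) (ascentNumbers n)
  ascentNumbers-suc n = begin
    map ascents (permutations (suc n))
      ↭⟨ Perm.map⁺ ascents (permutations-suc↭ n) ⟩
    map ascents (concatMap (insertions (suc n)) (permutations n))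
      ≡⟨ map-concatMap ascents (insertions (suc n)) (permutations n) ⟩
    concatMap (map ascents ∘ insertions (suc n)) (permutations n)
      ↭⟨ concatMap-↭ (permutations n) ascents-insertions′ ⟩
    concatMap (insertionAscents n ∘ ascents) (permutations n)
      ≡⟨ concatMap-map (insertionAscents n) ascents (permutations n) ⟨
    concatMap (insertionAscents n) (map ascents (permutations n)) ∎
    where
    open PermutationReasoning
    ascents-insertions′ : ∀ {w} → w ∈ permutations n →
      map ascents (insertions (suc n) w) ↭ insertionAscents n (ascents w)
    ascents-insertions′ {w} w∈ with ∈-permutations⁻ {n} w∈
    ... | refl , w⊆ , _ = ascents-insertions w (All.map (s≤s ∘ ∈-letters⇒≤) w⊆)

  -- The Eulerian recurrence

  count : ℕ → List ℕ → ℕ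
  count k = length ∘ filter (ℕ._≟ k)

  count-++ : ∀ k xs ys → count k (xs ++ ys) ≡ count k xs + count k ys
  count-++ k xs ys = trans (cong length (filter-++ (ℕ._≟ k) xs ys)) (length-++ (filter (ℕ._≟ k) xs))

  count-replicate : ∀ k p a → count k (replicate p a) ≡ p * count k [ a ]
  count-replicate k zero    a = refl
  count-replicate k (suc p) a = trans (count-++ k [ a ] (replicate p a)) (cong (count k [ a ] +_) (count-replicate k p a))

  count-↭ : ∀ k {xs ys} → xs ↭ ys → count k xs ≡ count k ys
  count-↭ k xs↭ys = ↭-length (filter-↭ (ℕ._≟ k) xs↭ys)

  *-count-[] : ∀ (f : ℕ → ℕ) k a → f a * count k [ a ] ≡ f k * count k [ a ]
  *-count-[] f k a with a ℕ.≟ k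
  ... | yes refl = refl
  ... | no  a≢k  = trans (vanish (f a)) (sym (vanish (f k)))
    where
    vanish : ∀ c → c * count k [ a ] ≡ 0
    vanish c = trans (cong (c *_) (cong length (filter-reject (ℕ._≟ k) a≢k))) (*-zeroʳ c)

  count-suc-[] : ∀ k a → count (suc k) [ suc a ] ≡ count k [ a ]
  count-suc-[] k a with a ℕ.≡ᵇ k
  ... | true  = refl
  ... | false = refl

  length-filter-∘ : ∀ {A : Set} (f : A → ℕ) k xs → length (filter ((ℕ._≟ k) ∘ f) xs) ≡ count k (map f xs)
  length-filter-∘ f k []       = refl
  length-filter-∘ f k (x ∷ xs) with f x ℕ.≡ᵇ k
  ... | true  = cong suc (length-filter-∘ f k xs)
  ... | false = length-filter-∘ f k xs

  count-insertionAscents : ∀ n k a → count k (insertionAscents n a) ≡ suc a * count k [ a ] + (n ∸ a) * count k [ suc a ]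
  count-insertionAscents n k a =
    trans (count-++ k (replicate (suc a) a) _) (cong₂ _+_ (count-replicate k (suc a) a) (count-replicate k (n ∸ a) (suc a)))

  count-zero-concatMap-insertionAscents : ∀ n as → count 0 (concatMap (insertionAscents n) as) ≡ count 0 as
  count-zero-concatMap-insertionAscents n []       = refl
  count-zero-concatMap-insertionAscents n (a ∷ as) = begin
    count 0 (insertionAscents n a ++ concatMap (insertionAscents n) as)
      ≡⟨ count-++ 0 (insertionAscents n a) _ ⟩
    count 0 (insertionAscents n a) + count 0 (concatMap (insertionAscents n) as)
      ≡⟨ cong₂ _+_ (count-insertionAscents n 0 a) (count-zero-concatMap-insertionAscents n as) ⟩
    (suc a * count 0 [ a ] + (n ∸ a) * 0) + count 0 as
      ≡⟨ cong (_+ count 0 as) (trans (cong₂ _+_ (*-count-[] suc 0 a) (*-zeroʳ (n ∸ a))) (+-identityʳ _)) ⟩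
    1 * count 0 [ a ] + count 0 as
      ≡⟨ cong (_+ count 0 as) (*-identityˡ _) ⟩
    count 0 [ a ] + count 0 as
      ≡⟨ count-++ 0 [ a ] as ⟨
    count 0 (a ∷ as) ∎
    where open ≡-Reasoning

  count-suc-concatMap-insertionAscents : ∀ n k as →
    count (suc k) (concatMap (insertionAscents n) as) ≡ suc (suc k) * count (suc k) as + (n ∸ k) * count k as
  count-suc-concatMap-insertionAscents n k [] = sym (cong₂ _+_ (*-zeroʳ (suc (suc k))) (*-zeroʳ (n ∸ k)))
  count-suc-concatMap-insertionAscents n k (a ∷ as) = begin
    count (suc k) (insertionAscents n a ++ concatMap (insertionAscents n) as)
      ≡⟨ count-++ (suc k) (insertionAscents n a) _ ⟩
    count (suc k) (insertionAscents n a) + count (suc k) (concatMap (insertionAscents n) as)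
      ≡⟨ cong₂ _+_ (trans (count-insertionAscents n (suc k) a) (cong ((suc a * x) +_) (cong ((n ∸ a) *_) (count-suc-[] k a))))
                   (count-suc-concatMap-insertionAscents n k as) ⟩
    (suc a * x + (n ∸ a) * y) + (suc (suc k) * X + (n ∸ k) * Y)
      ≡⟨ cong (_+ (suc (suc k) * X + (n ∸ k) * Y)) (cong₂ _+_ (*-count-[] suc (suc k) a) (*-count-[] (n ∸_) k a)) ⟩
    (suc (suc k) * x + (n ∸ k) * y) + (suc (suc k) * X + (n ∸ k) * Y)
      ≡⟨ regroup (suc (suc k)) (n ∸ k) x y X Y ⟩
    suc (suc k) * (x + X) + (n ∸ k) * (y + Y)
      ≡⟨ cong₂ (λ u v → suc (suc k) * u + (n ∸ k) * v) (count-++ (suc k) [ a ] as) (count-++ k [ a ] as) ⟨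
    suc (suc k) * count (suc k) (a ∷ as) + (n ∸ k) * count k (a ∷ as) ∎
    where
    open ≡-Reasoning
    x y X Y : ℕ
    x = count (suc k) [ a ]
    y = count k [ a ]
    X = count (suc k) as
    Y = count k as
    regroup : ∀ p q x y X Y → (p * x + q * y) + (p * X + q * Y) ≡ p * (x + X) + q * (y + Y)
    regroup = solve-∀

  eulerian≡count : ∀ n k → eulerian n k ≡ count k (ascentNumbers n)
  eulerian≡count n k = length-filter-∘ ascents k (permutations n)

  eulerian-suc-zero : ∀ n → eulerian (suc n) 0 ≡ eulerian n 0
  eulerian-suc-zero n = begin
    eulerian (suc n) 0                                         ≡⟨ eulerian≡count (suc n) 0 ⟩
    count 0 (ascentNumbers (suc n))                            ≡⟨ count-↭ 0 (ascentNumbers-suc n) ⟩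
    count 0 (concatMap (insertionAscents n) (ascentNumbers n)) ≡⟨ count-zero-concatMap-insertionAscents n (ascentNumbers n) ⟩
    count 0 (ascentNumbers n)                                  ≡⟨ eulerian≡count n 0 ⟨
    eulerian n 0                                               ∎
    where open ≡-Reasoning

  eulerian-suc-suc : ∀ n k → eulerian (suc n) (suc k) ≡ suc (suc k) * eulerian n (suc k) + (n ∸ k) * eulerian n k
  eulerian-suc-suc n k = begin
    eulerian (suc n) (suc k)
      ≡⟨ eulerian≡count (suc n) (suc k) ⟩
    count (suc k) (ascentNumbers (suc n))
      ≡⟨ count-↭ (suc k) (ascentNumbers-suc n) ⟩
    count (suc k) (concatMap (insertionAscents n) (ascentNumbers n))
      ≡⟨ count-suc-concatMap-insertionAscents n k (ascentNumbers n) ⟩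
    suc (suc k) * count (suc k) (ascentNumbers n) + (n ∸ k) * count k (ascentNumbers n)
      ≡⟨ cong₂ (λ u v → suc (suc k) * u + (n ∸ k) * v) (eulerian≡count n (suc k)) (eulerian≡count n k) ⟨
    suc (suc k) * eulerian n (suc k) + (n ∸ k) * eulerian n k ∎
    where open ≡-Reasoning

  eulerian-vanish : ∀ {n k} → n < k → eulerian n k ≡ 0
  eulerian-vanish {zero}  {suc k} _ = refl
  eulerian-vanish {suc n} {suc k} (s≤s n<k)
    rewrite eulerian-suc-suc n k | eulerian-vanish (m<n⇒m<1+n n<k) | m≤n⇒m∸n≡0 (<⇒≤ n<k) | *-zeroʳ (suc (suc k)) = refl


-- Worpitzky's identity and the Stirling numbers

module Stirling where

  open import Data.Nat as ℕ using (_+_; _*_; _^_; _!)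
  open import Data.Nat.Properties
  open import Data.Nat.Combinatorics using (_C_; nCn≡1; nC1≡n; k>n⇒nCk≡0; nCk+nC[k+1]≡[n+1]C[k+1])
  open import Data.Nat.Tactic.RingSolver using (solve-∀)
  open import Relation.Binary.PropositionalEquality
  open Eulerian using (eulerian-suc-zero; eulerian-suc-suc; eulerian-vanish)
  open ℕΣ
  open ≡-Reasoning

  m*mCn≡[1+n]*mC[1+n]+n*mCn : ∀ m n → m * (m C n) ≡ suc n * (m C suc n) + n * (m C n)
  m*mCn≡[1+n]*mC[1+n]+n*mCn zero    zero    = refl
  m*mCn≡[1+n]*mC[1+n]+n*mCn zero    (suc n) = sym (cong₂ _+_ (*-zeroʳ (suc (suc n))) (*-zeroʳ (suc n)))
  m*mCn≡[1+n]*mC[1+n]+n*mCn (suc m) zero    = trans (*-identityʳ (suc m)) (sym (trans (+-identityʳ _) (trans (*-identityˡ _) (nC1≡n (suc m)))))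
  m*mCn≡[1+n]*mC[1+n]+n*mCn (suc m) (suc n) = begin
    suc m * (suc m C suc n)                    ≡⟨ cong (suc m *_) (nCk+nC[k+1]≡[n+1]C[k+1] m n) ⟨
    suc m * (B₀ + B₁)                          ≡⟨ expand m B₀ B₁ ⟩
    (m * B₀ + m * B₁) + (B₀ + B₁)              ≡⟨ cong (_+ (B₀ + B₁)) (cong₂ _+_ (m*mCn≡[1+n]*mC[1+n]+n*mCn m n)
                                                                               (m*mCn≡[1+n]*mC[1+n]+n*mCn m (suc n))) ⟩
    ((suc n * B₁ + n * B₀) + (suc (suc n) * B₂ + suc n * B₁)) + (B₀ + B₁)
                                               ≡⟨ collect n B₀ B₁ B₂ ⟩
    suc (suc n) * (B₁ + B₂) + suc n * (B₀ + B₁) ≡⟨ cong₂ (λ u v → suc (suc n) * u + suc n * v)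
                                                      (nCk+nC[k+1]≡[n+1]C[k+1] m (suc n)) (nCk+nC[k+1]≡[n+1]C[k+1] m n) ⟩
    suc (suc n) * (suc m C suc (suc n)) + suc n * (suc m C suc n) ∎
    where
    B₀ B₁ B₂ : ℕ
    B₀ = m C n
    B₁ = m C suc n
    B₂ = m C suc (suc n)
    expand : ∀ m B₀ B₁ → suc m * (B₀ + B₁) ≡ (m * B₀ + m * B₁) + (B₀ + B₁)
    expand = solve-∀
    collect : ∀ n B₀ B₁ B₂ → ((suc n * B₁ + n * B₀) + (suc (suc n) * B₂ + suc n * B₁)) + (B₀ + B₁)
                             ≡ suc (suc n) * (B₁ + B₂) + suc n * (B₀ + B₁)
    collect = solve-∀

  worpitzky-weights : ∀ x {k n} → k ≤ n →
    suc k * ((x + k) C suc n) + (n ∸ k) * ((x + suc k) C suc n) ≡ x * ((x + k) C n)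
  worpitzky-weights x {k} {n} k≤n = +-cancelʳ-≡ (k * B₀) _ _ (begin
    (suc k * B₁ + (n ∸ k) * ((x + suc k) C suc n)) + k * B₀
      ≡⟨ cong (λ b → (suc k * B₁ + (n ∸ k) * b) + k * B₀)
           (trans (cong (_C suc n) (+-suc x k)) (sym (nCk+nC[k+1]≡[n+1]C[k+1] (x + k) n))) ⟩
    (suc k * B₁ + (n ∸ k) * (B₀ + B₁)) + k * B₀
      ≡⟨ regroup k (n ∸ k) B₀ B₁ ⟩
    suc (k + (n ∸ k)) * B₁ + (k + (n ∸ k)) * B₀
      ≡⟨ cong (λ m → suc m * B₁ + m * B₀) (m+[n∸m]≡n k≤n) ⟩
    suc n * B₁ + n * B₀
      ≡⟨ m*mCn≡[1+n]*mC[1+n]+n*mCn (x + k) n ⟨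
    (x + k) * B₀
      ≡⟨ *-distribʳ-+ B₀ x k ⟩
    x * B₀ + k * B₀ ∎)
    where
    B₀ B₁ : ℕ
    B₀ = (x + k) C n
    B₁ = (x + k) C suc n
    regroup : ∀ k d B₀ B₁ → (suc k * B₁ + d * (B₀ + B₁)) + k * B₀ ≡ suc (k + d) * B₁ + (k + d) * B₀
    regroup = solve-∀

  eulerian-sumTo-suc : ∀ n (g : ℕ → ℕ) →
    sumTo (suc n) (λ k → eulerian (suc n) k * g k) ≡
    sumTo n (λ k → eulerian n k * (suc k * g k + (n ∸ k) * g (suc k)))
  eulerian-sumTo-suc n g = begin
    sumTo (suc n) (λ k → E (suc n) k * g k)
      ≡⟨ sumTo-suc n (λ k → E (suc n) k * g k) ⟩
    E (suc n) 0 * g 0 + sumTo n (λ k → E (suc n) (suc k) * g (suc k))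
      ≡⟨ cong₂ _+_ (cong (_* g 0) (eulerian-suc-zero n))
                   (sumTo-cong n (λ k _ → cong (_* g (suc k)) (eulerian-suc-suc n k))) ⟩
    E n 0 * g 0 + sumTo n (λ k → (suc (suc k) * E n (suc k) + (n ∸ k) * E n k) * g (suc k))
      ≡⟨ cong (E n 0 * g 0 +_) (trans (sumTo-cong n (λ k _ → split (suc (suc k)) (n ∸ k) (E n (suc k)) (E n k) (g (suc k))))
                                       (sumTo-distrib-+ n _ _)) ⟩
    E n 0 * g 0 + (kept + raised)
      ≡⟨ +-assoc (E n 0 * g 0) kept raised ⟨
    (E n 0 * g 0 + kept) + raised
      ≡⟨ cong (_+ raised) kept-reindexed ⟩
    sumTo n (λ k → E n k * (suc k * g k)) + raised
      ≡⟨ sumTo-distrib-+ n _ _ ⟨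
    sumTo n (λ k → E n k * (suc k * g k) + E n k * ((n ∸ k) * g (suc k)))
      ≡⟨ sumTo-cong n (λ k _ → *-distribˡ-+ (E n k) _ _) ⟨
    sumTo n (λ k → E n k * (suc k * g k + (n ∸ k) * g (suc k))) ∎
    where
    E : ℕ → ℕ → ℕ
    E = eulerian
    split : ∀ a b e₁ e₀ y → (a * e₁ + b * e₀) * y ≡ e₁ * (a * y) + e₀ * (b * y)
    split = solve-∀
    kept raised : ℕ
    kept   = sumTo n (λ k → E n (suc k) * (suc (suc k) * g (suc k)))
    raised = sumTo n (λ k → E n k * ((n ∸ k) * g (suc k)))
    kept-reindexed : E n 0 * g 0 + kept ≡ sumTo n (λ k → E n k * (suc k * g k))
    kept-reindexed = begin
      E n 0 * g 0 + kept
        ≡⟨ cong (λ y → E n 0 * y + kept) (*-identityˡ (g 0)) ⟨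
      E n 0 * (1 * g 0) + kept
        ≡⟨ sumTo-suc n (λ k → E n k * (suc k * g k)) ⟨
      sumTo (suc n) (λ k → E n k * (suc k * g k))
        ≡⟨ sumTo-truncate _ (n≤1+n n) (λ m n<m → cong (_* (suc m * g m)) (eulerian-vanish n<m)) ⟩
      sumTo n (λ k → E n k * (suc k * g k)) ∎

  worpitzky : ∀ n x → x ^ n ≡ sumTo n (λ k → eulerian n k * ((x + k) C n))
  worpitzky zero    x = refl
  worpitzky (suc n) x = sym (begin
    sumTo (suc n) (λ k → eulerian (suc n) k * ((x + k) C suc n))
      ≡⟨ eulerian-sumTo-suc n (λ k → (x + k) C suc n) ⟩
    sumTo n (λ k → eulerian n k * (suc k * ((x + k) C suc n) + (n ∸ k) * ((x + suc k) C suc n)))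
      ≡⟨ sumTo-cong n (λ k k≤n → cong (eulerian n k *_) (worpitzky-weights x k≤n)) ⟩
    sumTo n (λ k → eulerian n k * (x * ((x + k) C n)))
      ≡⟨ sumTo-cong n (λ k _ → x*[y*z]≡y*[x*z] (eulerian n k) x _) ⟩
    sumTo n (λ k → x * (eulerian n k * ((x + k) C n)))
      ≡⟨ *-distribˡ-sumTo n x _ ⟨
    x * sumTo n (λ k → eulerian n k * ((x + k) C n))
      ≡⟨ cong (x *_) (worpitzky n x) ⟨
    x * x ^ n ∎)
    where
    x*[y*z]≡y*[x*z] : ∀ x y z → x * (y * z) ≡ y * (x * z)
    x*[y*z]≡y*[x*z] = solve-∀

  vandermonde : ∀ x k n → (x + k) C n ≡ sumTo n (λ m → (x C m) * (k C (n ∸ m)))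
  vandermonde x zero    zero    = refl
  vandermonde x zero    (suc n) = sym (begin
    sumTo n (λ m → (x C m) * (0 C (suc n ∸ m))) + (x C suc n) * (0 C (n ∸ n))
      ≡⟨ cong₂ _+_ (sumTo-zero n (λ m m≤n → trans (cong (λ i → (x C m) * (0 C i)) (+-∸-assoc 1 m≤n)) (*-zeroʳ (x C m))))
                   (trans (cong (λ i → (x C suc n) * (0 C i)) (n∸n≡0 n)) (*-identityʳ (x C suc n))) ⟩
    x C suc n
      ≡⟨ cong (_C suc n) (+-identityʳ x) ⟨
    (x + 0) C suc n ∎)
  vandermonde x (suc k) zero    = refl
  vandermonde x (suc k) (suc n) = begin
    (x + suc k) C suc n
      ≡⟨ cong (_C suc n) (+-suc x k) ⟩
    suc (x + k) C suc n
      ≡⟨ nCk+nC[k+1]≡[n+1]C[k+1] (x + k) n ⟨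
    (x + k) C n + (x + k) C suc n
      ≡⟨ cong₂ _+_ (vandermonde x k n) (vandermonde x k (suc n)) ⟩
    sumTo n (λ m → (x C m) * (k C (n ∸ m))) + (sumTo n (λ m → (x C m) * (k C (suc n ∸ m))) + (x C suc n) * (k C (n ∸ n)))
      ≡⟨ +-assoc (sumTo n _) (sumTo n _) _ ⟨
    (sumTo n (λ m → (x C m) * (k C (n ∸ m))) + sumTo n (λ m → (x C m) * (k C (suc n ∸ m)))) + (x C suc n) * (k C (n ∸ n))
      ≡⟨ cong₂ _+_ (trans (sym (sumTo-distrib-+ n _ _)) (sumTo-cong n pascal-term)) (cong (λ i → (x C suc n) * (k C i)) (n∸n≡0 n)) ⟩
    sumTo n (λ m → (x C m) * (suc k C (suc n ∸ m))) + (x C suc n) * (suc k C 0)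
      ≡⟨ cong (λ i → sumTo n (λ m → (x C m) * (suc k C (suc n ∸ m))) + (x C suc n) * (suc k C i)) (n∸n≡0 n) ⟨
    sumTo n (λ m → (x C m) * (suc k C (suc n ∸ m))) + (x C suc n) * (suc k C (n ∸ n)) ∎
    where
    pascal-term : ∀ m → m ≤ n → (x C m) * (k C (n ∸ m)) + (x C m) * (k C (suc n ∸ m)) ≡ (x C m) * (suc k C (suc n ∸ m))
    pascal-term m m≤n rewrite +-∸-assoc 1 m≤n =
      trans (sym (*-distribˡ-+ (x C m) _ _)) (cong ((x C m) *_) (nCk+nC[k+1]≡[n+1]C[k+1] k (n ∸ m)))

  sumTo-binomial-truncate : ∀ (a : ℕ → ℕ) {j n} → j ≤ n → sumTo n (λ m → a m * (j C m)) ≡ sumTo j (λ m → a m * (j C m))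
  sumTo-binomial-truncate a j≤n = sumTo-truncate _ j≤n (λ m j<m → trans (cong (a m *_) (k>n⇒nCk≡0 j<m)) (*-zeroʳ (a m)))

  binomial-basis-unique : ∀ n (a b : ℕ → ℕ) →
    (∀ x → sumTo n (λ m → a m * (x C m)) ≡ sumTo n (λ m → b m * (x C m))) →
    ∀ {m} → m ≤ n → a m ≡ b m
  binomial-basis-unique n a b a≡b m≤n = lower-coefficients m≤n ≤-refl
    where
    at : ∀ {j} → j ≤ n → sumTo j (λ m → a m * (j C m)) ≡ sumTo j (λ m → b m * (j C m))
    at j≤n = trans (sym (sumTo-binomial-truncate a j≤n)) (trans (a≡b _) (sumTo-binomial-truncate b j≤n))
    lower-coefficients : ∀ {j} → j ≤ n → ∀ {m} → m ≤ j → a m ≡ b m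
    lower-coefficients {zero} j≤n z≤n = trans (sym (*-identityʳ (a 0))) (trans (at j≤n) (*-identityʳ (b 0)))
    lower-coefficients {suc j} j<n m≤1+j with m≤n⇒m<n∨m≡n m≤1+j
    ... | inj₁ (s≤s m≤j) = lower-coefficients (<⇒≤ j<n) m≤j
    ... | inj₂ refl = begin
      a (suc j)                    ≡⟨ *-identityʳ (a (suc j)) ⟨
      a (suc j) * 1                ≡⟨ cong (a (suc j) *_) (nCn≡1 (suc j)) ⟨
      a (suc j) * (suc j C suc j)  ≡⟨ +-cancelˡ-≡ (sumTo j (λ m → b m * (suc j C m))) _ _ top ⟩
      b (suc j) * (suc j C suc j)  ≡⟨ cong (b (suc j) *_) (nCn≡1 (suc j)) ⟩
      b (suc j) * 1                ≡⟨ *-identityʳ (b (suc j)) ⟩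
      b (suc j)                    ∎
      where
      lower : sumTo j (λ m → a m * (suc j C m)) ≡ sumTo j (λ m → b m * (suc j C m))
      lower = sumTo-cong j (λ m m≤j → cong (_* (suc j C m)) (lower-coefficients (<⇒≤ j<n) m≤j))
      top : sumTo j (λ m → b m * (suc j C m)) + a (suc j) * (suc j C suc j) ≡
            sumTo j (λ m → b m * (suc j C m)) + b (suc j) * (suc j C suc j)
      top = trans (cong (_+ a (suc j) * (suc j C suc j)) (sym lower)) (at j<n)

  power-in-binomial-basis : ∀ n x →
    x ^ n ≡ sumTo n (λ m → sumTo n (λ k → eulerian n k * (k C (n ∸ m))) * (x C m))
  power-in-binomial-basis n x = begin
    x ^ n
      ≡⟨ worpitzky n x ⟩
    sumTo n (λ k → eulerian n k * ((x + k) C n))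
      ≡⟨ sumTo-cong n (λ k _ → trans (cong (eulerian n k *_) (vandermonde x k n)) (*-distribˡ-sumTo n (eulerian n k) _)) ⟩
    sumTo n (λ k → sumTo n (λ m → eulerian n k * ((x C m) * (k C (n ∸ m)))))
      ≡⟨ sumTo-comm n n _ ⟩
    sumTo n (λ m → sumTo n (λ k → eulerian n k * ((x C m) * (k C (n ∸ m)))))
      ≡⟨ sumTo-cong n (λ m _ → trans (sumTo-cong n (λ k _ → rearrange (eulerian n k) (x C m) (k C (n ∸ m))))
                                     (sym (*-distribʳ-sumTo n (x C m) _))) ⟩
    sumTo n (λ m → sumTo n (λ k → eulerian n k * (k C (n ∸ m))) * (x C m)) ∎
    where
    rearrange : ∀ e c d → e * (c * d) ≡ e * d * c
    rearrange = solve-∀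

  sumℕ≡sumTo : ∀ n g → sumℕ n g ≡ sumTo n g
  sumℕ≡sumTo zero    g = refl
  sumℕ≡sumTo (suc n) g = cong (_+ g (suc n)) (sumℕ≡sumTo n g)

  stirling-eulerian : ∀ S → IsStirling2 S → ∀ {n m} → m ≤ n →
    m ! * S n m ≡ sumTo n (λ k → eulerian n k * (k C (n ∸ m)))
  stirling-eulerian S isStirling {n} =
    binomial-basis-unique n (λ m → m ! * S n m) (λ m → sumTo n (λ k → eulerian n k * (k C (n ∸ m)))) (λ x → begin
    sumTo n (λ m → m ! * S n m * (x C m))  ≡⟨ sumTo-cong n (λ m _ → cong (_* (x C m)) (*-comm (m !) (S n m))) ⟩
    sumTo n (λ m → S n m * m ! * (x C m))  ≡⟨ sumℕ≡sumTo n _ ⟨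
    sumℕ n (λ m → S n m * m ! * (x C m))   ≡⟨ isStirling n x ⟨
    x ^ n                                  ≡⟨ power-in-binomial-basis n x ⟩
    sumTo n (λ m → sumTo n (λ k → eulerian n k * (k C (n ∸ m))) * (x C m)) ∎)

-- Binomial inversion and the coefficients of both sides

module Coefficients {c ℓ} (R : CommutativeRing c ℓ) where

  open import Data.Nat as ℕ using (_!)
  open import Data.List using ([]; _∷_)
  open import Data.Nat.Properties using (≰⇒>; ≤-<-trans; +-∸-assoc; <-irrefl; n≤1+n)
  open import Data.Nat.Combinatorics using (_C_; k>n⇒nCk≡0; nCk+nC[k+1]≡[n+1]C[k+1])
  open import Relation.Nullary using (yes; no)
  import Relation.Binary.PropositionalEquality as ≡
  open CommutativeRing R renaming (refl to ≈-refl)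
  open PolyDefs R
  open RangeSum commutativeSemiring
  open import Relation.Binary.Reasoning.Setoid setoid
  open import Algebra.Properties.Ring ring using (-‿distribʳ-*; -‿+-comm; -0#≈0#)
  open import Algebra.Properties.Semiring.Mult semiring using (_×_; ×-homo-+; ×1-homo-*)
  open import Algebra.Properties.CommutativeSemigroup +-commutativeSemigroup using (x∙yz≈y∙xz)
  open import Algebra.Solver.CommutativeMonoid *-commutativeMonoid using (solve; _⊜_) renaming (_⊕_ to _·_)
  open Eulerian using (eulerian-vanish)
  open Stirling using (stirling-eulerian)

  sumTo-neg : ∀ n (f : ℕ → Carrier) → sumTo n (λ k → - f k) ≈ - sumTo n f
  sumTo-neg zero    f = ≈-refl
  sumTo-neg (suc n) f = trans (+-congʳ (sumTo-neg n f)) (-‿+-comm _ _)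

  fromℕ≡×1# : ∀ n → fromℕ n ≡ n × 1#
  fromℕ≡×1# zero    = refl
  fromℕ≡×1# (suc n) = ≡.cong (1# +_) (fromℕ≡×1# n)

  fromℕ-+ : ∀ m n → fromℕ (m ℕ.+ n) ≈ fromℕ m + fromℕ n
  fromℕ-+ m n rewrite fromℕ≡×1# (m ℕ.+ n) | fromℕ≡×1# m | fromℕ≡×1# n = ×-homo-+ 1# m n

  fromℕ-* : ∀ m n → fromℕ (m ℕ.* n) ≈ fromℕ m * fromℕ n
  fromℕ-* m n rewrite fromℕ≡×1# (m ℕ.* n) | fromℕ≡×1# m | fromℕ≡×1# n = ×1-homo-* m n

  fromℕ-sumTo : ∀ n (f : ℕ → ℕ) → fromℕ (ℕΣ.sumTo n f) ≈ sumTo n (fromℕ ∘ f)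
  fromℕ-sumTo zero    f = ≈-refl
  fromℕ-sumTo (suc n) f = trans (fromℕ-+ (ℕΣ.sumTo n f) (f (suc n))) (+-congʳ (fromℕ-sumTo n f))

  fromℕ≡0⇒*≈0 : ∀ {m} x → m ≡ 0 → fromℕ m * x ≈ 0#
  fromℕ≡0⇒*≈0 x m≡0 = trans (*-congʳ (reflexive (≡.cong fromℕ m≡0))) (zeroˡ x)

  δ : ℕ → ℕ → Carrier
  δ zero    zero    = 1#
  δ zero    (suc j) = 0#
  δ (suc i) zero    = 0#
  δ (suc i) (suc j) = δ i j

  δ-≢ : ∀ i j → i ≢ j → δ i j ≈ 0#
  δ-≢ zero    zero    0≢0 = ⊥-elim (0≢0 refl)
  δ-≢ zero    (suc j) _   = ≈-refl
  δ-≢ (suc i) zero    _   = ≈-refl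
  δ-≢ (suc i) (suc j) i≢j = δ-≢ i j (i≢j ∘ ≡.cong suc)

  δ-refl : ∀ j → δ j j ≈ 1#
  δ-refl zero    = ≈-refl
  δ-refl (suc j) = δ-refl j

  sumTo-δ-below : ∀ n j (g : ℕ → Carrier) → n < j → sumTo n (λ i → g i * δ i j) ≈ 0#
  sumTo-δ-below n j g n<j =
    sumTo-zero n (λ i i≤n → trans (*-congˡ (δ-≢ i j (λ { refl → <-irrefl refl (≤-<-trans i≤n n<j) }))) (zeroʳ (g i)))

  sumTo-δ : ∀ n j (g : ℕ → Carrier) → (n < j → g j ≈ 0#) → sumTo n (λ i → g i * δ i j) ≈ g j
  sumTo-δ n j g g≈0 with j ℕ.≤? n
  ... | no  j≰n = trans (sumTo-δ-below n j g (≰⇒> j≰n)) (sym (g≈0 (≰⇒> j≰n)))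
  ... | yes j≤n = begin
    sumTo n (λ i → g i * δ i j)  ≈⟨ sumTo-truncate _ j≤n (λ i j<i → trans (*-congˡ (δ-≢ i j (λ { refl → <-irrefl refl j<i }))) (zeroʳ (g i))) ⟩
    sumTo j (λ i → g i * δ i j)  ≈⟨ diagonal j ⟩
    g j * 1#                     ≈⟨ *-identityʳ (g j) ⟩
    g j                          ∎
    where
    diagonal : ∀ j → sumTo j (λ i → g i * δ i j) ≈ g j * 1#
    diagonal zero    = ≈-refl
    diagonal (suc j) = trans (+-cong (sumTo-δ-below j (suc j) g ≤-refl) (*-congˡ (δ-refl j))) (+-identityˡ _)

  coeff-⊕ : ∀ p q j → coeff (p ⊕ q) j ≈ coeff p j + coeff q j
  coeff-⊕ []      q       j       = sym (+-identityˡ _)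
  coeff-⊕ (a ∷ p) []      j       = sym (+-identityʳ _)
  coeff-⊕ (a ∷ p) (b ∷ q) zero    = ≈-refl
  coeff-⊕ (a ∷ p) (b ∷ q) (suc j) = coeff-⊕ p q j

  coeff-sumP : ∀ n g j → coeff (sumP n g) j ≈ sumTo n (λ k → coeff (g k) j)
  coeff-sumP zero    g j = ≈-refl
  coeff-sumP (suc n) g j = trans (coeff-⊕ (sumP n g) (g (suc n)) j) (+-congʳ (coeff-sumP n g j))

  coeff-mono : ∀ a i j → coeff (mono a i) j ≈ a * δ i j
  coeff-mono a zero    zero    = sym (*-identityʳ a)
  coeff-mono a zero    (suc j) = sym (zeroʳ a)
  coeff-mono a (suc i) zero    = sym (zeroʳ a)
  coeff-mono a (suc i) (suc j) = coeff-mono a i j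

  -- (-1)^(p-j) C(p,j); the truncated p ∸ j is harmless since C(p,j) = 0 for p < j.
  signedBinomial : ℕ → ℕ → Carrier
  signedBinomial p j = fromℕ (p C j) * negOnePow (p ∸ j)

  signedBinomial-suc-zero : ∀ p → signedBinomial (suc p) 0 ≈ - signedBinomial p 0
  signedBinomial-suc-zero p = sym (-‿distribʳ-* _ _)

  signedBinomial-suc-suc : ∀ p j → signedBinomial (suc p) (suc j) ≈ signedBinomial p j + - signedBinomial p (suc j)
  signedBinomial-suc-suc p j = begin
    fromℕ (suc p C suc j) * negOnePow (p ∸ j)
      ≈⟨ *-congʳ (trans (reflexive (≡.cong fromℕ (≡.sym (nCk+nC[k+1]≡[n+1]C[k+1] p j)))) (fromℕ-+ (p C j) (p C suc j))) ⟩
    (fromℕ (p C j) + fromℕ (p C suc j)) * negOnePow (p ∸ j)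
      ≈⟨ distribʳ _ _ _ ⟩
    signedBinomial p j + fromℕ (p C suc j) * negOnePow (p ∸ j)
      ≈⟨ +-congˡ (flip p) ⟩
    signedBinomial p j + - signedBinomial p (suc j) ∎
    where
    flip : ∀ p → fromℕ (p C suc j) * negOnePow (p ∸ j) ≈ - signedBinomial p (suc j)
    flip zero = trans (zeroˡ _) (sym (trans (-‿cong (zeroˡ _)) -0#≈0#))
    flip (suc p) with j ℕ.≤? p
    ... | yes j≤p = trans (*-congˡ (reflexive (≡.cong negOnePow (+-∸-assoc 1 j≤p)))) (sym (-‿distribʳ-* _ _))
    ... | no  j≰p = trans (fromℕ≡0⇒*≈0 _ C≡0) (sym (trans (-‿cong (fromℕ≡0⇒*≈0 _ C≡0)) -0#≈0#))
      where
      C≡0 : suc p C suc j ≡ 0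
      C≡0 = k>n⇒nCk≡0 (s≤s (≰⇒> j≰p))

  inversionSum : ℕ → ℕ → Carrier
  inversionSum k j = sumTo k (λ p → fromℕ (k C p) * signedBinomial p j)

  inversionSum-suc : ∀ k j →
    inversionSum (suc k) j ≈ sumTo k (λ p → fromℕ (k C p) * signedBinomial (suc p) j) + inversionSum k j
  inversionSum-suc k j = begin
    inversionSum (suc k) j
      ≈⟨ sumTo-suc k _ ⟩
    fromℕ (k C 0) * Y 0 + sumTo k (λ p → fromℕ (suc k C suc p) * Y (suc p))
      ≈⟨ +-congˡ (trans (sumTo-cong k (λ p _ → trans (*-congʳ pascal) (distribʳ _ _ _))) (sumTo-distrib-+ k _ _)) ⟩
    fromℕ (k C 0) * Y 0 + (Z + sumTo k (λ p → fromℕ (k C suc p) * Y (suc p)))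
      ≈⟨ x∙yz≈y∙xz _ Z _ ⟩
    Z + (fromℕ (k C 0) * Y 0 + sumTo k (λ p → fromℕ (k C suc p) * Y (suc p)))
      ≈⟨ +-congˡ (sumTo-suc k (λ p → fromℕ (k C p) * Y p)) ⟨
    Z + sumTo (suc k) (λ p → fromℕ (k C p) * Y p)
      ≈⟨ +-congˡ (sumTo-truncate _ (n≤1+n k) (λ p k<p → fromℕ≡0⇒*≈0 _ (k>n⇒nCk≡0 k<p))) ⟩
    Z + inversionSum k j ∎
    where
    Y : ℕ → Carrier
    Y p = signedBinomial p j
    Z : Carrier
    Z = sumTo k (λ p → fromℕ (k C p) * Y (suc p))
    pascal : ∀ {p} → fromℕ (suc k C suc p) ≈ fromℕ (k C p) + fromℕ (k C suc p)
    pascal {p} = trans (reflexive (≡.cong fromℕ (≡.sym (nCk+nC[k+1]≡[n+1]C[k+1] k p)))) (fromℕ-+ (k C p) (k C suc p))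

  inversionSum≈δ : ∀ k j → inversionSum k j ≈ δ k j
  inversionSum≈δ zero    zero    = trans (*-cong one (trans (*-congʳ one) (*-identityˡ 1#))) (*-identityˡ 1#)
    where
    one : fromℕ 1 ≈ 1#
    one = +-identityʳ 1#
  inversionSum≈δ zero    (suc j) = trans (*-congˡ (zeroˡ _)) (zeroʳ _)
  inversionSum≈δ (suc k) zero    = begin
    inversionSum (suc k) 0
      ≈⟨ inversionSum-suc k 0 ⟩
    sumTo k (λ p → fromℕ (k C p) * signedBinomial (suc p) 0) + inversionSum k 0
      ≈⟨ +-congʳ (trans (sumTo-cong k (λ p _ → trans (*-congˡ (signedBinomial-suc-zero p)) (sym (-‿distribʳ-* _ _))))
                        (sumTo-neg k _)) ⟩
    - inversionSum k 0 + inversionSum k 0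
      ≈⟨ -‿inverseˡ _ ⟩
    0# ∎
  inversionSum≈δ (suc k) (suc j) = begin
    inversionSum (suc k) (suc j)
      ≈⟨ inversionSum-suc k (suc j) ⟩
    sumTo k (λ p → fromℕ (k C p) * signedBinomial (suc p) (suc j)) + inversionSum k (suc j)
      ≈⟨ +-congʳ (trans (sumTo-cong k (λ p _ → trans (*-congˡ (signedBinomial-suc-suc p j))
                                                     (trans (distribˡ _ _ _) (+-congˡ (sym (-‿distribʳ-* _ _))))))
                        (trans (sumTo-distrib-+ k _ _) (+-congˡ (sumTo-neg k _)))) ⟩
    (inversionSum k j + - inversionSum k (suc j)) + inversionSum k (suc j)
      ≈⟨ +-assoc _ _ _ ⟩
    inversionSum k j + (- inversionSum k (suc j) + inversionSum k (suc j))
      ≈⟨ +-congˡ (-‿inverseˡ _) ⟩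
    inversionSum k j + 0#
      ≈⟨ +-identityʳ _ ⟩
    inversionSum k j
      ≈⟨ inversionSum≈δ k j ⟩
    δ k j ∎

  binomial-inversion : ∀ {k n} j → k ≤ n → sumTo n (λ p → fromℕ (k C p) * signedBinomial p j) ≈ δ k j
  binomial-inversion {k} j k≤n =
    trans (sumTo-truncate _ k≤n (λ p k<p → fromℕ≡0⇒*≈0 _ (k>n⇒nCk≡0 k<p))) (inversionSum≈δ k j)

  coeff-lhs : ∀ n f j → coeff (lhs n f) j ≈ fromℕ (eulerian n j) * eval f (fromℕ j)
  coeff-lhs n f j = begin
    coeff (lhs n f) j                  ≈⟨ coeff-sumP n _ j ⟩
    sumTo n (λ k → coeff (mono (a k) k) j) ≈⟨ sumTo-cong n (λ k _ → coeff-mono (a k) k j) ⟩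
    sumTo n (λ k → a k * δ k j)        ≈⟨ sumTo-δ n j a (λ n<j → fromℕ≡0⇒*≈0 _ (eulerian-vanish n<j)) ⟩
    a j                                ∎
    where
    a : ℕ → Carrier
    a k = fromℕ (eulerian n k) * eval f (fromℕ k)

  rhsCoefficient : (ℕ → ℕ → ℕ) → ℕ → ℕ → Carrier → Carrier
  rhsCoefficient S n j y = sumTo n (λ m → fromℕ (m ! ℕ.* S n m) * (fromℕ ((n ∸ m) C j) * (negOnePow ((n ∸ m) ∸ j) * y)))

  coeff-rhs : ∀ S n f j → coeff (rhs S n f) j ≈ rhsCoefficient S n j (eval f (fromℕ j))
  coeff-rhs S n f j = trans (coeff-sumP n _ j) (sumTo-cong n (λ m _ → begin
    coeff (sumP (n ∸ m) (λ i → mono (a m i) i)) j  ≈⟨ coeff-sumP (n ∸ m) _ j ⟩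
    sumTo (n ∸ m) (λ i → coeff (mono (a m i) i) j)   ≈⟨ sumTo-cong (n ∸ m) (λ i _ → coeff-mono (a m i) i j) ⟩
    sumTo (n ∸ m) (λ i → a m i * δ i j)              ≈⟨ sumTo-δ (n ∸ m) j (a m) (λ n∸m<j → trans (*-congˡ (fromℕ≡0⇒*≈0 _ (k>n⇒nCk≡0 n∸m<j))) (zeroʳ _)) ⟩
    a m j                                            ∎))
    where
    a : ℕ → ℕ → Carrier
    a m i = fromℕ (m ! ℕ.* S n m) * (fromℕ ((n ∸ m) C i) * (negOnePow ((n ∸ m) ∸ i) * eval f (fromℕ i)))

  rhsCoefficient≈ : ∀ S → IsStirling2 S → ∀ n j y → rhsCoefficient S n j y ≈ fromℕ (eulerian n j) * y
  rhsCoefficient≈ S isStirling n j y = begin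
    sumTo n (λ m → fromℕ (m ! ℕ.* S n m) * w (n ∸ m))
      ≈⟨ sumTo-cong n (λ m m≤n → *-congʳ (stirling m≤n)) ⟩
    sumTo n (λ m → t (n ∸ m) * w (n ∸ m))
      ≈⟨ sumTo-reverse n (λ p → t p * w p) ⟩
    sumTo n (λ p → t p * w p)
      ≈⟨ sumTo-cong n (λ p _ → *-distribʳ-sumTo n (w p) _) ⟩
    sumTo n (λ p → sumTo n (λ k → (a k * fromℕ (k C p)) * w p))
      ≈⟨ sumTo-comm n n _ ⟨
    sumTo n (λ k → sumTo n (λ p → (a k * fromℕ (k C p)) * w p))
      ≈⟨ sumTo-cong n (λ k _ → trans (sumTo-cong n (λ p _ → regroup (a k) (fromℕ (k C p)) (fromℕ (p C j)) (negOnePow (p ∸ j)) y))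
                                     (sym (*-distribˡ-sumTo n (a k * y) _))) ⟩
    sumTo n (λ k → (a k * y) * sumTo n (λ p → fromℕ (k C p) * signedBinomial p j))
      ≈⟨ sumTo-cong n (λ k k≤n → *-congˡ (binomial-inversion j k≤n)) ⟩
    sumTo n (λ k → (a k * y) * δ k j)
      ≈⟨ sumTo-δ n j (λ k → a k * y) (λ n<j → fromℕ≡0⇒*≈0 y (eulerian-vanish n<j)) ⟩
    a j * y ∎
    where
    a : ℕ → Carrier
    a k = fromℕ (eulerian n k)
    t : ℕ → Carrier
    t p = sumTo n (λ k → a k * fromℕ (k C p))
    w : ℕ → Carrier
    w p = fromℕ (p C j) * (negOnePow (p ∸ j) * y)
    stirling : ∀ {m} → m ≤ n → fromℕ (m ! ℕ.* S n m) ≈ t (n ∸ m)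
    stirling m≤n = trans (reflexive (≡.cong fromℕ (stirling-eulerian S isStirling m≤n)))
                         (trans (fromℕ-sumTo n _) (sumTo-cong n (λ k _ → fromℕ-* (eulerian n k) _)))
    regroup : ∀ a b c s y → (a * b) * (c * (s * y)) ≈ (a * y) * (b * (c * s))
    regroup = solve 5 (λ a b c s y → (a · b) · (c · (s · y)) ⊜ (a · y) · (b · (c · s))) ≈-refl

lemma2p2 : ∀ {c ℓ} (R : CommutativeRing c ℓ) (S : ℕ → ℕ → ℕ) → IsStirling2 S →
           ∀ (n : ℕ) → 1 ≤ n → (f : PolyDefs.Poly R) →
           PolyDefs._≋_ R (PolyDefs.lhs R n f) (PolyDefs.rhs R S n f)
lemma2p2 R S isStirling n _ f j = begin
  coeff (lhs n f) j                            ≈⟨ coeff-lhs n f j ⟩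
  fromℕ (eulerian n j) * eval f (fromℕ j)     ≈⟨ rhsCoefficient≈ S isStirling n j _ ⟨
  rhsCoefficient S n j (eval f (fromℕ j))      ≈⟨ coeff-rhs S n f j ⟨
  coeff (rhs S n f) j                          ∎
  where
  open CommutativeRing R using (setoid; _*_)
  open PolyDefs R
  open Coefficients R
  open import Relation.Binary.Reasoning.Setoid setoid
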